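{- For every integer $n\ge1$, $$D_n(1,-1,t)=\sum_{k=0}^{n-1}\binom{n-1-k}{k}k!\,t^k.$$
   Context: For $n\in\mathbb{N}$, $[n]_{p,q}=\sum_{i+j=n-1}p^iq^j$ and $\binom{n}{k}_{p,q}=\frac{[n]_{p,q}\cdots[n-k+1]_{p,q}}{[1]_{p,q}\cdots[k]_{p,q}}$. The polynomials $D_n(p,q,t)$ ($n\ge1$) are defined by the formal power series identity $$\sum_{n\ge0}D_{n+1}(p,q,t)x^n=\cfrac{1}{1-[1]_{p,q}x-\cfrac{\binom{2}{2}_{p,q}t\,x^2}{1-[2]_{p,q}x-\cfrac{\binom{3}{2}_{p,q}t\,x^2}{1-[3]_{p,q}x-\cdots}}}$$ (level $m$: $b_m=[m+1]_{p,q}$, $\lambda_m=\binom{m+1}{2}_{p,q}t$). Ordinary binomial coefficients $\binom{a}{k}$ with $k>a$ are $0$. -}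

module Defs where

open import Level using (Level)
open import Algebra.Bundles using (CommutativeRing)
open import Data.Nat.Base as ℕ using (ℕ; zero; suc; _∸_)
open import Data.List.Base using (List; []; _∷_; _++_; [_]; lookup; length)
open import Data.Fin.Base using (Fin; fromℕ<)

module PQ {c ℓ : Level} (R : CommutativeRing c ℓ) where
  open CommutativeRing R
  open import Algebra.Bundles using (Semiring)
  open import Algebra.Definitions.RawSemiring (Semiring.rawSemiring semiring) public
    using (_^_; _×_)

  nat : ℕ → Carrier
  nat k = k × 1#

  sumTo : ℕ → (ℕ → Carrier) → Carrier
  sumTo zero    f = 0#
  sumTo (suc n) f = sumTo n f + f n

  pqInt : Carrier → Carrier → ℕ → Carrier
  pqInt p q n = sumTo n (λ i → (p ^ i) * (q ^ (n ∸ 1 ∸ i)))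

  -- p,q-binomial coefficient, given by the (p,q)-Pascal recurrence
  --   binom(n+1,k+1) = p^(n-k) binom(n,k) + q^(k+1) binom(n,k+1),
  -- which is the polynomial in ℤ[p,q] equal to the ratio
  -- [n]⋯[n-k+1] / ([1]⋯[k]).
  pqBinom : Carrier → Carrier → ℕ → ℕ → Carrier
  pqBinom p q n       zero    = 1#
  pqBinom p q zero    (suc k) = 0#
  pqBinom p q (suc n) (suc k) =
    (p ^ (n ∸ k)) * pqBinom p q n k + (q ^ suc k) * pqBinom p q n (suc k)

  bJ : Carrier → Carrier → ℕ → Carrier
  bJ p q m = pqInt p q (suc m)

  λJ : Carrier → Carrier → Carrier → ℕ → Carrier
  λJ p q t m = pqBinom p q (suc m) 2 * t

  at : List Carrier → ℕ → Carrier
  at []       _       = 0#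
  at (x ∷ xs) zero    = x
  at (x ∷ xs) (suc i) = at xs i

  -- rows n m = [F_m[0], …, F_m[n]] where F_m is the formal power series
  --   F_m = 1 / (1 - b_m x - λ_{m+1} x² F_{m+1}),
  -- i.e. the unique series with F_m = 1 + (b_m x + λ_{m+1} x² F_{m+1}) F_m:
  --   F_m[0] = 1,
  --   F_m[n] = b_m F_m[n-1] + λ_{m+1} Σ_{i+j=n-2} F_{m+1}[i] F_m[j].
  rows : Carrier → Carrier → Carrier → ℕ → ℕ → List Carrier
  rows p q t zero    m = [ 1# ]
  rows p q t (suc n) m = prev ++ [ new ]
    where
    prev : List Carrier
    prev = rows p q t n m
    next : List Carrier
    next = rows p q t n (suc m)
    new : Carrier
    new = bJ p q m * at prev n
        + λJ p q t (suc m) * sumTo n (λ i → at next i * at prev (n ∸ 1 ∸ i))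

  -- D_{n+1}(p,q,t) = coefficient of x^n in F_0.  (D_0 is not defined in
  -- the paper; we set it to 0, it is never used.)
  D : ℕ → Carrier → Carrier → Carrier → Carrier
  D zero    p q t = 0#
  D (suc n) p q t = at (rows p q t n 0) n

module Submission where

open import Defs
open import Level using (Level)
open import Algebra.Bundles using (CommutativeRing)
open import Data.Nat.Base using (ℕ; zero; suc; _∸_; _≤_; _!; _*_)
open import Data.Nat.Combinatorics using (_C_)
open import Data.Nat.Base as ℕ using (_<_; s≤s)
open import Data.Nat.Properties as ℕₚ using (≤-refl; ≤-trans; n≤1+n; n∸n≡0; m+n∸m≡n; ∸-+-assoc; m+[n∸m]≡n; +-∸-assoc)
import Relation.Binary.PropositionalEquality as ≡

-- At p = 1, q = -1 the J-fraction has b_m = 1, 0, 1, 0, … and λ_{m+1} = (⌊m/2⌋ + 1) t.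
-- Put B_j(n) = C(n+j,n)² n!, A_{j+1}(n) = C(n+j,n) C(n+j+1,n) n!, A_0(n) = δ_{n0}, and
--   G_{2j}   = Σ_n A_j(n) tⁿ x²ⁿ (1-x)^-(j+n),
--   G_{2j+1} = Σ_n B_j(n) tⁿ x²ⁿ (1-x)^-(j+n+1).
-- Comparing coefficients, G_{m+1} = G_m + b_m x G_{m+1} + λ_{m+1} x² G_{m+2}: this comes
-- down to the identities B_j(n+1) = A_j(n+1) + (j+1) A_{j+1}(n) and
-- A_{j+1}(n+1) = B_j(n+1) + (j+1) B_{j+1}(n), both consequences of (a+1) C(a+b+1,a+1) = (b+1) C(a+b+1,a).
-- So the quotients G_{m+1}/G_m satisfy F_m = 1/(1 - b_m x - λ_{m+1} x² F_{m+1}), the equations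
-- defining the tails F_m of the fraction; as G_0 = 1, Σ D_{n+1} xⁿ = F_0 = G_1 = Σ_k k! tᵏ x²ᵏ (1-x)^-(k+1).

module Coefficients where
  open import Data.Nat.Base using (ℕ; zero; suc; _+_; _*_; _∸_; _<_; _≤_; _!; s≤s)
  open import Data.Nat.Properties
  open import Data.Nat.Combinatorics using (_C_; nCn≡1; nCk+nC[k+1]≡[n+1]C[k+1]; k>n⇒nCk≡0)
  open import Data.Nat.Solver using (module +-*-Solver)
  open import Relation.Binary.PropositionalEquality
  open import Relation.Nullary using (yes; no)
  open +-*-Solver

  pascal : ℕ → ℕ → ℕ
  pascal zero    b       = 1
  pascal (suc a) zero    = 1
  pascal (suc a) (suc b) = pascal (suc a) b + pascal a (suc b)

  pascal-zeroʳ : ∀ a → pascal a 0 ≡ 1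
  pascal-zeroʳ zero    = refl
  pascal-zeroʳ (suc a) = refl

  pascal-oneʳ : ∀ a → pascal a 1 ≡ suc a
  pascal-oneʳ zero    = refl
  pascal-oneʳ (suc a) = cong suc (pascal-oneʳ a)

  pascal-oneˡ : ∀ b → pascal 1 b ≡ suc b
  pascal-oneˡ zero    = refl
  pascal-oneˡ (suc b) = trans (cong (_+ 1) (pascal-oneˡ b)) (+-comm (suc b) 1)

  pascal≡C : ∀ a b → pascal a b ≡ (a + b) C a
  pascal≡C zero    b       = refl
  pascal≡C (suc a) zero    = trans (sym (nCn≡1 (suc a))) (cong (_C suc a) (sym (+-identityʳ (suc a))))
  pascal≡C (suc a) (suc b) = begin
    pascal (suc a) b + pascal a (suc b)          ≡⟨ cong₂ _+_ (pascal≡C (suc a) b) (pascal≡C a (suc b)) ⟩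
    (suc a + b) C suc a + (a + suc b) C a        ≡⟨ cong (λ k → k C suc a + (a + suc b) C a) (sym (+-suc a b)) ⟩
    (a + suc b) C suc a + (a + suc b) C a        ≡⟨ +-comm ((a + suc b) C suc a) _ ⟩
    (a + suc b) C a + (a + suc b) C suc a        ≡⟨ nCk+nC[k+1]≡[n+1]C[k+1] (a + suc b) a ⟩
    suc (a + suc b) C suc a                      ∎
    where open ≡-Reasoning

  suc*pascal-swap : ∀ a b → suc a * pascal (suc a) b ≡ suc b * pascal a (suc b)
  suc*pascal-swap zero b rewrite pascal-oneˡ b =
    solve 1 (λ b → (con 1 :+ b) :+ con 0 := (con 1 :+ b) :* con 1) refl b
  suc*pascal-swap (suc a) zero rewrite pascal-oneʳ a =
    solve 1 (λ a → con 2 :+ a :* con 1 := (con 1 :+ (con 1 :+ a)) :+ con 0) refl a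
  suc*pascal-swap (suc a) (suc b) = begin
    (2 + a) * (U + X)
      ≡⟨ solve 3 (λ a U X → (con 2 :+ a) :* (U :+ X) := (con 2 :+ a) :* U :+ (X :+ (con 1 :+ a) :* X)) refl a U X ⟩
    (2 + a) * U + (X + (1 + a) * X)
      ≡⟨ cong₂ (λ u x → u + (X + x)) (suc*pascal-swap (suc a) b) (suc*pascal-swap a (suc b)) ⟩
    (1 + b) * X + (X + (2 + b) * Y)
      ≡⟨ solve 3 (λ b X Y → (con 1 :+ b) :* X :+ (X :+ (con 2 :+ b) :* Y) := (con 2 :+ b) :* (X :+ Y)) refl b X Y ⟩
    (2 + b) * (X + Y)
      ∎
    where
    open ≡-Reasoning
    U = pascal (suc (suc a)) b
    X = pascal (suc a) (suc b)
    Y = pascal a (suc (suc b))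

  -- invPow e r = [xʳ] (1-x)^-e  and  shiftedInvPow e n N = [x^N] x²ⁿ (1-x)^-e
  invPow : ℕ → ℕ → ℕ
  invPow zero    zero    = 1
  invPow zero    (suc r) = 0
  invPow (suc e) r       = pascal e r

  shiftedInvPow : ℕ → ℕ → ℕ → ℕ
  shiftedInvPow e zero    N             = invPow e N
  shiftedInvPow e (suc n) zero          = 0
  shiftedInvPow e (suc n) (suc zero)    = 0
  shiftedInvPow e (suc n) (suc (suc N)) = shiftedInvPow e n N

  invPow-zeroʳ : ∀ e → invPow e 0 ≡ 1
  invPow-zeroʳ zero    = refl
  invPow-zeroʳ (suc e) = pascal-zeroʳ e

  shiftedInvPow-suc : ∀ e n N →
    shiftedInvPow (suc e) n (suc N) ≡ shiftedInvPow (suc e) n N + shiftedInvPow e n (suc N)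
  shiftedInvPow-suc zero    zero    N             = refl
  shiftedInvPow-suc (suc e) zero    N             = refl
  shiftedInvPow-suc e       (suc n) zero          = refl
  shiftedInvPow-suc e       (suc n) (suc zero)    = constant-term n
    where
    constant-term : ∀ n → shiftedInvPow (suc e) n 0 ≡ shiftedInvPow e n 0
    constant-term zero    = trans (invPow-zeroʳ (suc e)) (sym (invPow-zeroʳ e))
    constant-term (suc n) = refl
  shiftedInvPow-suc e       (suc n) (suc (suc N)) = shiftedInvPow-suc e n N

  shiftedInvPow-< : ∀ e n N → N < n + n → shiftedInvPow e n N ≡ 0
  shiftedInvPow-< e (suc n) zero          _         = refl
  shiftedInvPow-< e (suc n) (suc zero)    _         = refl
  shiftedInvPow-< e (suc n) (suc (suc N)) (s≤s N<) =
    shiftedInvPow-< e n N (≤-pred (subst (suc (suc N) ≤_) (+-suc n n) N<))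

  shiftedInvPow-+ : ∀ e n r → shiftedInvPow (suc e) n (n + n + r) ≡ pascal e r
  shiftedInvPow-+ e zero    r = refl
  shiftedInvPow-+ e (suc n) r rewrite +-suc n n = shiftedInvPow-+ e n r

  shiftedInvPow≡C : ∀ n N → shiftedInvPow (suc n) n N ≡ (N ∸ n) C n
  shiftedInvPow≡C n N with n + n ≤? N
  ... | yes 2n≤N = begin
    shiftedInvPow (suc n) n N            ≡⟨ cong (shiftedInvPow (suc n) n) (sym N≡) ⟩
    shiftedInvPow (suc n) n (n + n + r)  ≡⟨ shiftedInvPow-+ n n r ⟩
    pascal n r                           ≡⟨ pascal≡C n r ⟩
    (n + r) C n                          ≡⟨ cong (_C n) (sym N∸n≡) ⟩
    (N ∸ n) C n                          ∎
    where
    open ≡-Reasoning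
    r = N ∸ (n + n)
    N≡ : n + n + r ≡ N
    N≡ = m+[n∸m]≡n 2n≤N
    N∸n≡ : N ∸ n ≡ n + r
    N∸n≡ = begin
      N ∸ n            ≡⟨ cong (_∸ n) (sym N≡) ⟩
      n + n + r ∸ n    ≡⟨ cong (_∸ n) (+-assoc n n r) ⟩
      n + (n + r) ∸ n  ≡⟨ m+n∸m≡n n (n + r) ⟩
      n + r            ∎
  ... | no 2n≰N = trans (shiftedInvPow-< (suc n) n N N<2n) (sym (k>n⇒nCk≡0 (N∸n<n n N<2n)))
    where
    N<2n : N < n + n
    N<2n = ≰⇒> 2n≰N
    N∸n<n : ∀ n → N < n + n → N ∸ n < n
    N∸n<n zero    ()
    N∸n<n (suc n) = m<n+o⇒m∸n<o N (suc n)

  evenWeight : ℕ → ℕ → ℕ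
  evenWeight zero    zero    = 1
  evenWeight zero    (suc n) = 0
  evenWeight (suc j) n       = pascal n j * pascal n (suc j) * n !

  oddWeight : ℕ → ℕ → ℕ
  oddWeight j n = pascal n j * pascal n j * n !

  evenWeight-zeroʳ : ∀ j → evenWeight j 0 ≡ 1
  evenWeight-zeroʳ zero    = refl
  evenWeight-zeroʳ (suc j) = refl

  oddWeight-suc : ∀ j n → oddWeight j (suc n) ≡ evenWeight j (suc n) + suc j * evenWeight (suc j) n
  oddWeight-suc zero n rewrite pascal-zeroʳ n | pascal-oneʳ n =
    solve 2 (λ n F → con 1 :* con 1 :* (F :+ n :* F)
                   := con 0 :+ (con 1 :+ con 0) :* (con 1 :* (con 1 :+ n) :* F)) refl n (n !)
  oddWeight-suc (suc j) n = begin
    (Q + Y) * (Q + Y) * (F + n * F)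
      ≡⟨ solve 4 (λ Q Y F n → (Q :+ Y) :* (Q :+ Y) :* (F :+ n :* F)
                            := Q :* (Q :+ Y) :* (F :+ n :* F) :+ Y :* F :* ((con 1 :+ n) :* (Q :+ Y))) refl Q Y F n ⟩
    Q * (Q + Y) * (F + n * F) + Y * F * ((1 + n) * (Q + Y))
      ≡⟨ cong (λ z → Q * (Q + Y) * (F + n * F) + Y * F * z) (suc*pascal-swap n (suc j)) ⟩
    Q * (Q + Y) * (F + n * F) + Y * F * ((2 + j) * Z)
      ≡⟨ solve 6 (λ Q Y F n j Z → Q :* (Q :+ Y) :* (F :+ n :* F) :+ Y :* F :* ((con 2 :+ j) :* Z)
                                := Q :* (Q :+ Y) :* (F :+ n :* F) :+ (con 2 :+ j) :* (Y :* Z :* F)) refl Q Y F n j Z ⟩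
    Q * (Q + Y) * (F + n * F) + (2 + j) * (Y * Z * F)
      ∎
    where
    open ≡-Reasoning
    Q = pascal (suc n) j
    Y = pascal n (suc j)
    Z = pascal n (suc (suc j))
    F = n !

  evenWeight-suc : ∀ j n → evenWeight (suc j) (suc n) ≡ oddWeight j (suc n) + suc j * oddWeight (suc j) n
  evenWeight-suc j n = begin
    Q * (Q + Y) * (F + n * F)
      ≡⟨ solve 4 (λ Q Y F n → Q :* (Q :+ Y) :* (F :+ n :* F)
                            := Q :* Q :* (F :+ n :* F) :+ Y :* F :* ((con 1 :+ n) :* Q)) refl Q Y F n ⟩
    Q * Q * (F + n * F) + Y * F * ((1 + n) * Q)
      ≡⟨ cong (λ z → Q * Q * (F + n * F) + Y * F * z) (suc*pascal-swap n j) ⟩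
    Q * Q * (F + n * F) + Y * F * ((1 + j) * Y)
      ≡⟨ solve 5 (λ Q Y F n j → Q :* Q :* (F :+ n :* F) :+ Y :* F :* ((con 1 :+ j) :* Y)
                              := Q :* Q :* (F :+ n :* F) :+ (con 1 :+ j) :* (Y :* Y :* F)) refl Q Y F n j ⟩
    Q * Q * (F + n * F) + (1 + j) * (Y * Y * F)
      ∎
    where
    open ≡-Reasoning
    Q = pascal (suc n) j
    Y = pascal n (suc j)
    F = n !

  -- b_m = levelWeight m and λ_{2j+m+1} = fallWeight j m · t at p = 1, q = -1
  levelWeight : ℕ → ℕ
  levelWeight zero          = 1
  levelWeight (suc zero)    = 0
  levelWeight (suc (suc m)) = levelWeight m

  fallWeight : ℕ → ℕ → ℕ
  fallWeight j zero          = suc j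
  fallWeight j (suc zero)    = suc j
  fallWeight j (suc (suc m)) = fallWeight (suc j) m

  fallWeight-suc : ∀ j m → fallWeight (suc j) m ≡ suc (fallWeight j m)
  fallWeight-suc j zero          = refl
  fallWeight-suc j (suc zero)    = refl
  fallWeight-suc j (suc (suc m)) = fallWeight-suc (suc j) m

  -- coeff j m n N = [tⁿ x^N] G_{2j+m}, where A = evenWeight and B = oddWeight
  coeff : ℕ → ℕ → ℕ → ℕ → ℕ
  coeff j zero          n N = evenWeight j n * shiftedInvPow (j + n) n N
  coeff j (suc zero)    n N = oddWeight j n * shiftedInvPow (suc (j + n)) n N
  coeff j (suc (suc m)) n N = coeff (suc j) m n N

  shift : (ℕ → ℕ) → ℕ → ℕ
  shift f zero    = 0
  shift f (suc n) = f n

  coeff-recurrence : ∀ j m n N →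
    coeff j (suc m) n (suc (suc N)) ≡
    coeff j m n (suc (suc N))
      + (levelWeight m * coeff j (suc m) n (suc N) + shift (λ k → fallWeight j m * coeff j (suc (suc m)) k N) n)
  coeff-recurrence j zero zero N rewrite evenWeight-zeroʳ j | shiftedInvPow-suc (j + 0) 0 (suc N) =
    solve 2 (λ x y → con 1 :* (x :+ y) := con 1 :* y :+ (con 1 :* (con 1 :* x) :+ con 0)) refl
      (shiftedInvPow (suc (j + 0)) 0 (suc N)) (shiftedInvPow (j + 0) 0 (suc (suc N)))
  coeff-recurrence j zero (suc n) N rewrite +-suc j n | shiftedInvPow-suc (suc (j + n)) (suc n) (suc N) | oddWeight-suc j n =
    solve 5 (λ a j a′ w₁ w₂ → (a :+ (con 1 :+ j) :* a′) :* (w₁ :+ w₂)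
                            := a :* w₂ :+ (con 1 :* ((a :+ (con 1 :+ j) :* a′) :* w₁) :+ (con 1 :+ j) :* (a′ :* w₂))) refl
      (evenWeight j (suc n)) j (evenWeight (suc j) n)
      (shiftedInvPow (suc (suc (j + n))) (suc n) (suc N)) (shiftedInvPow (suc (j + n)) n N)
  coeff-recurrence j (suc zero) zero N =
    solve 1 (λ x → con 1 :* x := con 1 :* x :+ (con 0 :+ con 0)) refl (shiftedInvPow (suc (j + 0)) 0 (suc (suc N)))
  coeff-recurrence j (suc zero) (suc n) N rewrite +-suc j n | evenWeight-suc j n =
    solve 5 (λ b j b′ w y → (b :+ (con 1 :+ j) :* b′) :* w := b :* w :+ (con 0 :* y :+ (con 1 :+ j) :* (b′ :* w))) refl
      (oddWeight j (suc n)) j (oddWeight (suc j) n) (shiftedInvPow (suc (suc (j + n))) n N) (coeff j 2 (suc n) (suc N))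
  coeff-recurrence j (suc (suc m)) n N = coeff-recurrence (suc j) m n N

  coeff-recurrence₁ : ∀ j m n → coeff j (suc m) n 1 ≡ coeff j m n 1 + levelWeight m * coeff j (suc m) n 0
  coeff-recurrence₁ j zero zero rewrite evenWeight-zeroʳ j | shiftedInvPow-suc (j + 0) 0 0 =
    solve 2 (λ x y → con 1 :* (x :+ y) := con 1 :* y :+ con 1 :* (con 1 :* x)) refl
      (shiftedInvPow (suc (j + 0)) 0 0) (shiftedInvPow (j + 0) 0 1)
  coeff-recurrence₁ j zero (suc n) rewrite *-zeroʳ (oddWeight j (suc n)) | *-zeroʳ (evenWeight j (suc n)) = refl
  coeff-recurrence₁ j (suc zero) zero =
    solve 2 (λ x y → con 1 :* x := con 1 :* x :+ con 0 :* y) refl (shiftedInvPow (suc (j + 0)) 0 1) (shiftedInvPow (suc (j + 0)) 0 0)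
  coeff-recurrence₁ j (suc zero) (suc n) rewrite *-zeroʳ (oddWeight j (suc n)) | *-zeroʳ (evenWeight (suc j) (suc n)) = refl
  coeff-recurrence₁ j (suc (suc m)) n = coeff-recurrence₁ (suc j) m n

  coeff-< : ∀ j m n N → N < n → coeff j m n N ≡ 0
  coeff-< j zero n N N<n
    rewrite shiftedInvPow-< (j + n) n N (≤-trans N<n (m≤m+n n n)) = *-zeroʳ (evenWeight j n)
  coeff-< j (suc zero) n N N<n
    rewrite shiftedInvPow-< (suc (j + n)) n N (≤-trans N<n (m≤m+n n n)) = *-zeroʳ (oddWeight j n)
  coeff-< j (suc (suc m)) n N N<n = coeff-< (suc j) m n N N<n

  coeff-zero-zero : ∀ j m → coeff j m 0 0 ≡ 1
  coeff-zero-zero j zero       rewrite evenWeight-zeroʳ j | invPow-zeroʳ (j + 0) = refl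
  coeff-zero-zero j (suc zero) rewrite pascal-zeroʳ (j + 0) = refl
  coeff-zero-zero j (suc (suc m)) = coeff-zero-zero (suc j) m

  coeff-level₀ : ∀ n N → coeff 0 0 n (suc N) ≡ 0
  coeff-level₀ zero    N = refl
  coeff-level₀ (suc n) N = refl

  coeff-level₁ : ∀ n N → coeff 0 1 n N ≡ ((N ∸ n) C n) * n !
  coeff-level₁ n N rewrite pascal-zeroʳ n | shiftedInvPow≡C n N =
    solve 2 (λ x f → con 1 :* con 1 :* f :* x := x :* f) refl ((N ∸ n) C n) (n !)

open Coefficients

module Sums {c ℓ : Level} (R : CommutativeRing c ℓ) where
  open CommutativeRing R renaming (_*_ to _·_)
  open PQ R using (sumTo)
  open import Relation.Binary.Reasoning.Setoid setoid
  open import Algebra.Properties.CommutativeSemigroup +-commutativeSemigroup using (interchange)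

  sumTo-cong : ∀ n {f g : ℕ → Carrier} → (∀ i → i < n → f i ≈ g i) → sumTo n f ≈ sumTo n g
  sumTo-cong zero    f≈g = refl
  sumTo-cong (suc n) f≈g = +-cong (sumTo-cong n (λ i i<n → f≈g i (≤-trans i<n (n≤1+n n)))) (f≈g n ≤-refl)

  sumTo-zero : ∀ n (f : ℕ → Carrier) → (∀ i → i < n → f i ≈ 0#) → sumTo n f ≈ 0#
  sumTo-zero zero    f f≈0 = refl
  sumTo-zero (suc n) f f≈0 =
    trans (+-cong (sumTo-zero n f (λ i i<n → f≈0 i (≤-trans i<n (n≤1+n n)))) (f≈0 n ≤-refl)) (+-identityʳ 0#)

  sumTo-+ : ∀ n (f g : ℕ → Carrier) → sumTo n (λ i → f i + g i) ≈ sumTo n f + sumTo n g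
  sumTo-+ zero    f g = sym (+-identityˡ 0#)
  sumTo-+ (suc n) f g = trans (+-congʳ (sumTo-+ n f g)) (interchange _ _ _ _)

  sumTo-*ˡ : ∀ n a (f : ℕ → Carrier) → a · sumTo n f ≈ sumTo n (λ i → a · f i)
  sumTo-*ˡ zero    a f = zeroʳ a
  sumTo-*ˡ (suc n) a f = trans (distribˡ a (sumTo n f) (f n)) (+-congʳ (sumTo-*ˡ n a f))

  sumTo-*ʳ : ∀ n a (f : ℕ → Carrier) → sumTo n f · a ≈ sumTo n (λ i → f i · a)
  sumTo-*ʳ n a f = trans (*-comm _ a) (trans (sumTo-*ˡ n a f) (sumTo-cong n (λ i _ → *-comm a (f i))))

  sumTo-suc-head : ∀ n (f : ℕ → Carrier) → sumTo (suc n) f ≈ f 0 + sumTo n (λ i → f (suc i))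
  sumTo-suc-head zero    f = +-comm 0# (f 0)
  sumTo-suc-head (suc n) f = trans (+-congʳ (sumTo-suc-head n f)) (+-assoc (f 0) _ _)

  sumTo-triangle : ∀ N (H : ℕ → ℕ → Carrier) →
    sumTo N (λ i → sumTo (suc i) (λ a → H a i)) ≈ sumTo N (λ a → sumTo (N ∸ a) (λ c → H a (a ℕ.+ c)))
  sumTo-triangle zero    H = refl
  sumTo-triangle (suc N) H = begin
    sumTo N (λ i → sumTo (suc i) (λ a → H a i)) + (sumTo N (λ a → H a N) + H N N)
      ≈⟨ +-congʳ (sumTo-triangle N H) ⟩
    sumTo N row + (sumTo N (λ a → H a N) + H N N)
      ≈⟨ +-assoc _ _ _ ⟨
    (sumTo N row + sumTo N (λ a → H a N)) + H N N
      ≈⟨ +-cong (sumTo-+ N _ _) last ⟨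
    sumTo N (λ a → row a + H a N) + sumTo (suc N ∸ N) (λ c → H N (N ℕ.+ c))
      ≈⟨ +-congʳ (sumTo-cong N (λ a a<N → extend a (≤-trans (n≤1+n a) a<N))) ⟨
    sumTo N (λ a → sumTo (suc N ∸ a) (λ c → H a (a ℕ.+ c))) + sumTo (suc N ∸ N) (λ c → H N (N ℕ.+ c))
      ∎
    where
    row : ℕ → Carrier
    row a = sumTo (N ∸ a) (λ c → H a (a ℕ.+ c))
    extend : ∀ a → a ≤ N → sumTo (suc N ∸ a) (λ c → H a (a ℕ.+ c)) ≈ row a + H a N
    extend a a≤N = trans (reflexive (≡.cong (λ k → sumTo k (λ c → H a (a ℕ.+ c))) (+-∸-assoc 1 a≤N)))
                         (+-congˡ (reflexive (≡.cong (H a) (m+[n∸m]≡n a≤N))))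
    last : sumTo (suc N ∸ N) (λ c → H N (N ℕ.+ c)) ≈ H N N
    last = trans (extend N ≤-refl)
                 (trans (+-congʳ (reflexive (≡.cong (λ k → sumTo k (λ c → H N (N ℕ.+ c))) (n∸n≡0 N)))) (+-identityˡ _))

  conv : (ℕ → Carrier) → (ℕ → Carrier) → ℕ → Carrier
  conv f g n = sumTo (suc n) (λ i → f i · g (n ∸ i))

  conv-assoc : ∀ (f g h : ℕ → Carrier) n → conv (conv f g) h n ≈ conv f (conv g h) n
  conv-assoc f g h n = begin
    sumTo (suc n) (λ i → sumTo (suc i) (λ a → f a · g (i ∸ a)) · h (n ∸ i))
      ≈⟨ sumTo-cong (suc n) (λ i _ → sumTo-*ʳ (suc i) (h (n ∸ i)) _) ⟩
    sumTo (suc n) (λ i → sumTo (suc i) (λ a → f a · g (i ∸ a) · h (n ∸ i)))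
      ≈⟨ sumTo-triangle (suc n) (λ a i → f a · g (i ∸ a) · h (n ∸ i)) ⟩
    sumTo (suc n) (λ a → sumTo (suc n ∸ a) (λ c → f a · g (a ℕ.+ c ∸ a) · h (n ∸ (a ℕ.+ c))))
      ≈⟨ sumTo-cong (suc n) factor ⟩
    sumTo (suc n) (λ a → f a · conv g h (n ∸ a))
      ∎
    where
    factor : ∀ a → a < suc n →
      sumTo (suc n ∸ a) (λ c → f a · g (a ℕ.+ c ∸ a) · h (n ∸ (a ℕ.+ c))) ≈ f a · conv g h (n ∸ a)
    factor a (s≤s a≤n) = begin
      sumTo (suc n ∸ a) (λ c → f a · g (a ℕ.+ c ∸ a) · h (n ∸ (a ℕ.+ c)))
        ≡⟨ ≡.cong (λ k → sumTo k (λ c → f a · g (a ℕ.+ c ∸ a) · h (n ∸ (a ℕ.+ c)))) (+-∸-assoc 1 a≤n) ⟩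
      sumTo (suc (n ∸ a)) (λ c → f a · g (a ℕ.+ c ∸ a) · h (n ∸ (a ℕ.+ c)))
        ≈⟨ sumTo-cong (suc (n ∸ a)) (λ c _ → trans (*-assoc (f a) _ _)
             (*-congˡ (*-cong (reflexive (≡.cong g (m+n∸m≡n a c))) (reflexive (≡.cong h (≡.sym (∸-+-assoc n a c))))))) ⟩
      sumTo (suc (n ∸ a)) (λ c → f a · (g c · h (n ∸ a ∸ c)))
        ≈⟨ sumTo-*ˡ (suc (n ∸ a)) (f a) _ ⟨
      f a · conv g h (n ∸ a)
        ∎

  conv-unitʳ : ∀ (f g : ℕ → Carrier) n → g 0 ≈ 1# → (∀ k → g (suc k) ≈ 0#) → conv f g n ≈ f n
  conv-unitʳ f g n g0≈1 gsuc≈0 = begin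
    sumTo n (λ i → f i · g (n ∸ i)) + f n · g (n ∸ n)
      ≈⟨ +-cong (sumTo-zero n _ (λ i i<n → trans (*-congˡ (below i i<n)) (zeroʳ (f i)))) (*-congˡ at-n) ⟩
    0# + f n · 1#
      ≈⟨ trans (+-identityˡ _) (*-identityʳ (f n)) ⟩
    f n
      ∎
    where
    below : ∀ i → i < n → g (n ∸ i) ≈ 0#
    below i i<n = trans (reflexive (≡.cong g (+-∸-assoc 1 i<n))) (gsuc≈0 _)
    at-n : g (n ∸ n) ≈ 1#
    at-n = trans (reflexive (≡.cong g (n∸n≡0 n))) g0≈1

module JFraction {c ℓ : Level} (R : CommutativeRing c ℓ) (p q t : CommutativeRing.Carrier R) where
  open CommutativeRing R renaming (_*_ to _·_)
  open PQ R using (sumTo; bJ; λJ; at; rows; D)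
  open Sums R
  open import Relation.Binary.Reasoning.Setoid setoid
  open import Data.List.Base using (List; []; _∷_; _++_; [_]; length)
  open import Data.List.Properties using (length-++)
  open import Data.Nat.Induction using (<-rec)
  open import Data.Sum.Base using (inj₁; inj₂)

  F : ℕ → ℕ → Carrier
  F m n = at (rows p q t n m) n

  private
    at-++ˡ : ∀ (xs : List Carrier) y i → i < length xs → at (xs ++ [ y ]) i ≡.≡ at xs i
    at-++ˡ (x ∷ xs) y zero    _         = ≡.refl
    at-++ˡ (x ∷ xs) y (suc i) (s≤s i<n) = at-++ˡ xs y i i<n

    at-++ʳ : ∀ (xs : List Carrier) y → at (xs ++ [ y ]) (length xs) ≡.≡ y
    at-++ʳ []       y = ≡.refl
    at-++ʳ (x ∷ xs) y = at-++ʳ xs y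

  length-rows : ∀ n m → length (rows p q t n m) ≡.≡ suc n
  length-rows zero    m = ≡.refl
  length-rows (suc n) m =
    ≡.trans (length-++ (rows p q t n m)) (≡.trans (ℕₚ.+-comm _ 1) (≡.cong suc (length-rows n m)))

  at-rows : ∀ n m i → i ≤ n → at (rows p q t n m) i ≡.≡ F m i
  at-rows zero    m zero _   = ≡.refl
  at-rows (suc n) m i   i≤n with ℕₚ.m≤n⇒m<n∨m≡n i≤n
  ... | inj₂ ≡.refl       = ≡.refl
  ... | inj₁ (s≤s i≤n′)   =
    ≡.trans (at-++ˡ (rows p q t n m) _ i (≡.subst (i <_) (≡.sym (length-rows n m)) (s≤s i≤n′)))
            (at-rows n m i i≤n′)

  F-suc : ∀ m n →
    F m (suc n) ≈ bJ p q m · F m n + λJ p q t (suc m) · sumTo n (λ i → F (suc m) i · F m (n ∸ 1 ∸ i))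
  F-suc m n = trans
    (reflexive (≡.trans (≡.cong (at (rows p q t n m ++ _)) (≡.sym (length-rows n m))) (at-++ʳ (rows p q t n m) _)))
    (+-cong (*-congˡ (reflexive (at-rows n m n ≤-refl)))
            (*-congˡ (sumTo-cong n (λ i i<n →
              *-cong (reflexive (at-rows n (suc m) i (≤-trans (n≤1+n i) i<n)))
                     (reflexive (at-rows n m (n ∸ 1 ∸ i) (≤-trans (ℕₚ.m∸n≤m _ i) (ℕₚ.m∸n≤m n 1))))))))

  module Ratio (G : ℕ → ℕ → Carrier)
    (G-origin : ∀ m → G m 0 ≈ 1#)
    (G-recurrence₁ : ∀ m → G (suc m) 1 ≈ G m 1 + bJ p q m · G (suc m) 0)
    (G-recurrence : ∀ m N → G (suc m) (suc (suc N)) ≈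
                      G m (suc (suc N)) + (bJ p q m · G (suc m) (suc N) + λJ p q t (suc m) · G (suc (suc m)) N))
    where

    F*G≈G : ∀ k m → conv (F m) (G m) k ≈ G (suc m) k
    F*G≈G = <-rec (λ k → ∀ m → conv (F m) (G m) k ≈ G (suc m) k) step
      where
      step : ∀ k → (∀ {j} → j < k → ∀ m → conv (F m) (G m) j ≈ G (suc m) j) → ∀ m → conv (F m) (G m) k ≈ G (suc m) k
      step zero    _  m = trans (+-identityˡ _) (trans (*-identityˡ _) (trans (G-origin m) (sym (G-origin (suc m)))))
      step (suc K) ih m = begin
        conv f g (suc K)
          ≈⟨ sumTo-suc-head (suc K) _ ⟩
        1# · g (suc K) + sumTo (suc K) (λ i → F m (suc i) · g (K ∸ i))
          ≈⟨ +-cong (*-identityˡ _) (sumTo-cong (suc K) (λ i _ → *-congʳ (F-suc m i))) ⟩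
        g (suc K) + sumTo (suc K) (λ i → (b · f i + λ′ · V i) · g (K ∸ i))
          ≈⟨ +-congˡ (sumTo-cong (suc K) (λ i _ → trans (distribʳ _ _ _) (+-cong (*-assoc _ _ _) (*-assoc _ _ _)))) ⟩
        g (suc K) + sumTo (suc K) (λ i → b · (f i · g (K ∸ i)) + λ′ · (V i · g (K ∸ i)))
          ≈⟨ +-congˡ (trans (sumTo-+ (suc K) _ _) (+-cong (sym (sumTo-*ˡ (suc K) b _)) (sym (sumTo-*ˡ (suc K) λ′ _)))) ⟩
        g (suc K) + (b · conv f g K + λ′ · sumTo (suc K) (λ i → V i · g (K ∸ i)))
          ≈⟨ +-congˡ (+-cong (*-congˡ (ih ≤-refl m)) (*-congˡ V-sum)) ⟩
        g (suc K) + (b · G (suc m) K + λ′ · sumTo K (λ i → conv (F (suc m)) f i · g (K ∸ suc i)))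
          ≈⟨ close K ≤-refl ⟩
        G (suc m) (suc K)
          ∎
        where
        f = F m
        g = G m
        b = bJ p q m
        λ′ = λJ p q t (suc m)
        V : ℕ → Carrier
        V i = sumTo i (λ a → F (suc m) a · f (i ∸ 1 ∸ a))
        V-sum : sumTo (suc K) (λ i → V i · g (K ∸ i)) ≈ sumTo K (λ i → conv (F (suc m)) f i · g (K ∸ suc i))
        V-sum = trans (sumTo-suc-head K _) (trans (+-congʳ (zeroˡ _)) (+-identityˡ _))
        close : ∀ J → J ≤ K →
          g (suc J) + (b · G (suc m) J + λ′ · sumTo J (λ i → conv (F (suc m)) f i · g (J ∸ suc i))) ≈ G (suc m) (suc J)
        close zero     _   = trans (+-congˡ (trans (+-congˡ (zeroʳ _)) (+-identityʳ _))) (sym (G-recurrence₁ m))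
        close (suc J) J<K = trans (+-congˡ (+-congˡ (*-congˡ F*F*G≈G))) (sym (G-recurrence m J))
          where
          J<1+K : J < suc K
          J<1+K = s≤s (≤-trans (n≤1+n J) J<K)
          F*F*G≈G : conv (conv (F (suc m)) f) g J ≈ G (suc (suc m)) J
          F*F*G≈G = begin
            conv (conv (F (suc m)) f) g J   ≈⟨ conv-assoc (F (suc m)) f g J ⟩
            conv (F (suc m)) (conv f g) J   ≈⟨ sumTo-cong (suc J) (λ a _ → *-congˡ (ih (ℕₚ.≤-<-trans (ℕₚ.m∸n≤m J a) J<1+K) m)) ⟩
            conv (F (suc m)) (G (suc m)) J  ≈⟨ ih J<1+K (suc m) ⟩
            G (suc (suc m)) J               ∎

    D≈G₁ : (∀ N → G 0 (suc N) ≈ 0#) → ∀ N → D (suc N) p q t ≈ G 1 N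
    D≈G₁ G₀-suc N = trans (sym (conv-unitʳ (F 0) (G 0) N (G-origin 0) G₀-suc)) (F*G≈G N 0)

module AtOneMinusOne {c ℓ : Level} (R : CommutativeRing c ℓ) where
  open CommutativeRing R renaming (_*_ to _·_)
  open PQ R using (nat; sumTo; pqBinom; bJ; _^_)
  open Sums R using (sumTo-cong; sumTo-suc-head)
  open import Algebra.Properties.Ring ring using (-1*x≈-x; -‿involutive)
  open import Relation.Binary.Reasoning.Setoid setoid

  1^n≈1 : ∀ n → 1# ^ n ≈ 1#
  1^n≈1 zero    = refl
  1^n≈1 (suc n) = trans (*-identityˡ _) (1^n≈1 n)

  [-1]^suc : ∀ n → (- 1#) ^ suc n ≈ - ((- 1#) ^ n)
  [-1]^suc n = -1*x≈-x _

  [-1]^2*x≈x : ∀ x → (- 1#) ^ 2 · x ≈ x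
  [-1]^2*x≈x x = begin
    (- 1#) ^ 2 · x   ≈⟨ *-congʳ (trans ([-1]^suc 1) (-‿cong ([-1]^suc 0))) ⟩
    - - 1# · x       ≈⟨ *-congʳ (-‿involutive 1#) ⟩
    1# · x           ≈⟨ *-identityˡ x ⟩
    x                ∎

  alternatingSum : ℕ → Carrier
  alternatingSum m = sumTo (suc m) (λ i → (- 1#) ^ (m ∸ i))

  alternatingSum≈levelWeight : ∀ m → alternatingSum m ≈ nat (levelWeight m)
  alternatingSum≈levelWeight zero = +-comm 0# 1#
  alternatingSum≈levelWeight (suc zero) = begin
    alternatingSum 1                 ≈⟨ sumTo-suc-head 1 (λ i → (- 1#) ^ (1 ∸ i)) ⟩
    (- 1#) ^ 1 + alternatingSum 0    ≈⟨ +-cong ([-1]^suc 0) (+-identityˡ 1#) ⟩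
    - 1# + 1#                        ≈⟨ -‿inverseˡ 1# ⟩
    0#                               ∎
  alternatingSum≈levelWeight (suc (suc m)) = begin
    alternatingSum (suc (suc m))
      ≈⟨ trans (sumTo-suc-head (suc (suc m)) term) (+-congˡ (sumTo-suc-head (suc m) (λ i → term (suc i)))) ⟩
    (- 1#) ^ suc (suc m) + ((- 1#) ^ suc m + alternatingSum m)
      ≈⟨ +-congʳ ([-1]^suc (suc m)) ⟩
    - ((- 1#) ^ suc m) + ((- 1#) ^ suc m + alternatingSum m)
      ≈⟨ +-assoc _ _ _ ⟨
    (- ((- 1#) ^ suc m) + (- 1#) ^ suc m) + alternatingSum m
      ≈⟨ trans (+-congʳ (-‿inverseˡ _)) (+-identityˡ _) ⟩
    alternatingSum m
      ≈⟨ alternatingSum≈levelWeight m ⟩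
    nat (levelWeight m)
      ∎
    where
    term : ℕ → Carrier
    term i = (- 1#) ^ (suc (suc m) ∸ i)

  bJ≈levelWeight : ∀ m → bJ 1# (- 1#) m ≈ nat (levelWeight m)
  bJ≈levelWeight m =
    trans (sumTo-cong (suc m) (λ i _ → trans (*-congʳ (1^n≈1 i)) (*-identityˡ _))) (alternatingSum≈levelWeight m)

  binom₁ binom₂ : ℕ → Carrier
  binom₁ n = pqBinom 1# (- 1#) n 1
  binom₂ n = pqBinom 1# (- 1#) n 2

  binom₁-suc : ∀ n → binom₁ (suc n) + binom₁ n ≈ 1#
  binom₁-suc n = begin
    (1# ^ n · 1# + (- 1#) ^ 1 · binom₁ n) + binom₁ n
                                                       ≈⟨ +-congʳ (+-cong (trans (*-identityʳ _) (1^n≈1 n)) (*-congʳ (*-identityʳ (- 1#)))) ⟩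
    (1# + - 1# · binom₁ n) + binom₁ n                  ≈⟨ +-congʳ (+-congˡ (-1*x≈-x _)) ⟩
    (1# + - binom₁ n) + binom₁ n                       ≈⟨ trans (+-assoc _ _ _) (trans (+-congˡ (-‿inverseˡ _)) (+-identityʳ 1#)) ⟩
    1#                                                 ∎

  binom₂-suc : ∀ n → binom₂ (suc n) ≈ binom₁ n + binom₂ n
  binom₂-suc n = +-cong (trans (*-congʳ (1^n≈1 (n ∸ 1))) (*-identityˡ _)) ([-1]^2*x≈x (binom₂ n))

  binom₂-suc-suc : ∀ n → binom₂ (suc (suc n)) ≈ 1# + binom₂ n
  binom₂-suc-suc n = begin
    binom₂ (suc (suc n))                   ≈⟨ trans (binom₂-suc (suc n)) (+-congˡ (binom₂-suc n)) ⟩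
    binom₁ (suc n) + (binom₁ n + binom₂ n) ≈⟨ +-assoc _ _ _ ⟨
    (binom₁ (suc n) + binom₁ n) + binom₂ n ≈⟨ +-congʳ (binom₁-suc n) ⟩
    1# + binom₂ n                          ∎

  binom₂≈fallWeight : ∀ m → binom₂ (suc (suc m)) ≈ nat (fallWeight 0 m)
  binom₂≈fallWeight zero          = binom₂-suc-suc 0
  binom₂≈fallWeight (suc zero)    = trans (binom₂-suc-suc 1) (+-congˡ (trans (binom₂-suc 0) (+-identityʳ 0#)))
  binom₂≈fallWeight (suc (suc m)) = begin
    binom₂ (4 ℕ.+ m)                   ≈⟨ binom₂-suc-suc (suc (suc m)) ⟩
    1# + binom₂ (2 ℕ.+ m)              ≈⟨ +-congˡ (binom₂≈fallWeight m) ⟩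
    nat (suc (fallWeight 0 m))         ≡⟨ ≡.cong nat (fallWeight-suc 0 m) ⟨
    nat (fallWeight 1 m)               ∎

module Polynomial {c ℓ : Level} (R : CommutativeRing c ℓ) (t : CommutativeRing.Carrier R) where
  open CommutativeRing R renaming (_*_ to _·_)
  open PQ R using (nat; sumTo; _^_)
  open Sums R using (sumTo-cong; sumTo-+; sumTo-*ˡ; sumTo-suc-head)
  open import Algebra.Properties.Semiring.Mult semiring using (×-homo-+; ×1-homo-*)

  poly : ℕ → (ℕ → ℕ) → Carrier
  poly K f = sumTo K (λ n → nat (f n) · t ^ n)

  poly-cong : ∀ K {f g : ℕ → ℕ} → (∀ n → f n ≡.≡ g n) → poly K f ≈ poly K g
  poly-cong K f≡g = sumTo-cong K (λ n _ → reflexive (≡.cong (λ a → nat a · t ^ n) (f≡g n)))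

  poly-suc : ∀ K (f : ℕ → ℕ) → f K ≡.≡ 0 → poly (suc K) f ≈ poly K f
  poly-suc K f fK≡0 = trans (+-congˡ (trans (*-congʳ (reflexive (≡.cong nat fK≡0))) (zeroˡ _))) (+-identityʳ _)

  poly-+ : ∀ K (f g : ℕ → ℕ) → poly K f + poly K g ≈ poly K (λ n → f n ℕ.+ g n)
  poly-+ K f g = trans (sym (sumTo-+ K _ _))
    (sumTo-cong K (λ n _ → trans (sym (distribʳ _ _ _)) (*-congʳ (sym (×-homo-+ 1# (f n) (g n))))))

  nat·poly : ∀ K a (f : ℕ → ℕ) → nat a · poly K f ≈ poly K (λ n → a * f n)
  nat·poly K a f = trans (sumTo-*ˡ K _ _)
    (sumTo-cong K (λ n _ → trans (sym (*-assoc _ _ _)) (*-congʳ (sym (×1-homo-* a (f n))))))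

  t·poly : ∀ K (f : ℕ → ℕ) → t · poly K f ≈ poly (suc K) (shift f)
  t·poly K f = trans (sumTo-*ˡ K _ _) (trans
    (sumTo-cong K (λ n _ → trans (sym (*-assoc _ _ _)) (trans (*-congʳ (*-comm t _)) (*-assoc _ _ _))))
    (sym (trans (sumTo-suc-head K _) (trans (+-congʳ (zeroˡ _)) (+-identityˡ _)))))

module ExplicitSeries {c ℓ : Level} (R : CommutativeRing c ℓ) (t : CommutativeRing.Carrier R) where
  open CommutativeRing R renaming (_*_ to _·_)
  open PQ R using (nat; sumTo; bJ; λJ; pqBinom)
  open Sums R using (sumTo-zero)
  open Polynomial R t
  open AtOneMinusOne R using (bJ≈levelWeight; binom₂≈fallWeight)
  open import Relation.Binary.Reasoning.Setoid setoid

  G : ℕ → ℕ → Carrier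
  G m N = poly (suc N) (λ n → coeff 0 m n N)

  private
    scaled-coeff-top : ∀ a m N → a * coeff 0 m (suc N) N ≡.≡ 0
    scaled-coeff-top a m N = ≡.trans (≡.cong (a *_) (coeff-< 0 m (suc N) N ≤-refl)) (ℕₚ.*-zeroʳ a)

    bJ·G : ∀ m k N → bJ 1# (- 1#) m · G k N ≈ poly (suc (suc N)) (λ n → levelWeight m * coeff 0 k n N)
    bJ·G m k N = begin
      bJ 1# (- 1#) m · G k N        ≈⟨ *-congʳ (bJ≈levelWeight m) ⟩
      nat (levelWeight m) · G k N   ≈⟨ nat·poly (suc N) (levelWeight m) _ ⟩
      poly (suc N) f                ≈⟨ poly-suc (suc N) f (scaled-coeff-top (levelWeight m) k N) ⟨
      poly (suc (suc N)) f          ∎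
      where
      f : ℕ → ℕ
      f n = levelWeight m * coeff 0 k n N

    λJ·G : ∀ m k N → λJ 1# (- 1#) t (suc m) · G k N ≈ poly (3 ℕ.+ N) (shift (λ n → fallWeight 0 m * coeff 0 k n N))
    λJ·G m k N = begin
      (pqBinom 1# (- 1#) (2 ℕ.+ m) 2 · t) · G k N   ≈⟨ *-congʳ (*-congʳ (binom₂≈fallWeight m)) ⟩
      (nat (fallWeight 0 m) · t) · G k N            ≈⟨ trans (*-congʳ (*-comm _ t)) (*-assoc _ _ _) ⟩
      t · (nat (fallWeight 0 m) · G k N)            ≈⟨ *-congˡ (nat·poly (suc N) (fallWeight 0 m) _) ⟩
      t · poly (suc N) f                            ≈⟨ t·poly (suc N) f ⟩
      poly (2 ℕ.+ N) (shift f)                      ≈⟨ poly-suc (2 ℕ.+ N) (shift f) (scaled-coeff-top (fallWeight 0 m) k N) ⟨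
      poly (3 ℕ.+ N) (shift f)                      ∎
      where
      f : ℕ → ℕ
      f n = fallWeight 0 m * coeff 0 k n N

  G-origin : ∀ m → G m 0 ≈ 1#
  G-origin m = trans (+-identityˡ _) (trans (*-identityʳ _)
    (trans (reflexive (≡.cong nat (coeff-zero-zero 0 m))) (+-identityʳ 1#)))

  G₀-suc : ∀ N → G 0 (suc N) ≈ 0#
  G₀-suc N = sumTo-zero (suc (suc N)) _ (λ n _ → trans (*-congʳ (reflexive (≡.cong nat (coeff-level₀ n N)))) (zeroˡ _))

  G-recurrence₁ : ∀ m → G (suc m) 1 ≈ G m 1 + bJ 1# (- 1#) m · G (suc m) 0
  G-recurrence₁ m = sym (begin
    G m 1 + bJ 1# (- 1#) m · G (suc m) 0   ≈⟨ +-congˡ (bJ·G m (suc m) 0) ⟩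
    poly 2 Q + poly 2 X                    ≈⟨ poly-+ 2 Q X ⟩
    poly 2 (λ n → Q n ℕ.+ X n)             ≈⟨ poly-cong 2 (λ n → ≡.sym (coeff-recurrence₁ 0 m n)) ⟩
    G (suc m) 1                            ∎)
    where
    Q X : ℕ → ℕ
    Q n = coeff 0 m n 1
    X n = levelWeight m * coeff 0 (suc m) n 0

  G-recurrence : ∀ m N → G (suc m) (suc (suc N)) ≈
    G m (suc (suc N)) + (bJ 1# (- 1#) m · G (suc m) (suc N) + λJ 1# (- 1#) t (suc m) · G (suc (suc m)) N)
  G-recurrence m N = sym (begin
    G m (2 ℕ.+ N) + (bJ 1# (- 1#) m · G (suc m) (suc N) + λJ 1# (- 1#) t (suc m) · G (2 ℕ.+ m) N)
      ≈⟨ +-congˡ (+-cong (bJ·G m (suc m) (suc N)) (λJ·G m (2 ℕ.+ m) N)) ⟩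
    poly (3 ℕ.+ N) Q + (poly (3 ℕ.+ N) X + poly (3 ℕ.+ N) Y)
      ≈⟨ trans (+-congˡ (poly-+ (3 ℕ.+ N) X Y)) (poly-+ (3 ℕ.+ N) Q _) ⟩
    poly (3 ℕ.+ N) (λ n → Q n ℕ.+ (X n ℕ.+ Y n))
      ≈⟨ poly-cong (3 ℕ.+ N) (λ n → ≡.sym (coeff-recurrence 0 m n N)) ⟩
    G (suc m) (2 ℕ.+ N)
      ∎)
    where
    Q X Y : ℕ → ℕ
    Q n = coeff 0 m n (2 ℕ.+ N)
    X n = levelWeight m * coeff 0 (suc m) n (suc N)
    Y = shift (λ n → fallWeight 0 m * coeff 0 (2 ℕ.+ m) n N)

theorem3p7 : {c ℓ : Level} (R : CommutativeRing c ℓ) (t : CommutativeRing.Carrier R) (n : ℕ) → 1 ≤ n →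
    CommutativeRing._≈_ R
      (PQ.D R n (CommutativeRing.1# R) (CommutativeRing.-_ R (CommutativeRing.1# R)) t)
      (PQ.sumTo R n (λ k → CommutativeRing._*_ R (PQ.nat R (((n ∸ 1 ∸ k) C k) * (k !))) (PQ._^_ R t k)))
theorem3p7 R t zero    ()
theorem3p7 R t (suc N) _ = trans (D≈G₁ G₀-suc N) (poly-cong (suc N) (λ n → coeff-level₁ n N))
  where
  open CommutativeRing R using (1#; -_; trans)
  open Polynomial R t using (poly-cong)
  open ExplicitSeries R t
  open JFraction R 1# (- 1#) t
  open Ratio G G-origin G-recurrence₁ G-recurrence
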